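{- Let $0\le k\le k+p<n$ be integers and let $A=a_1\cdots a_n$ be a binary string with $a_1=1$ and $w(A)=k+p+1$. Let $A^\infty$ be generated from $A$ by the symmetric shift register with parameters $k,p,n$. Then $V(A^\infty)$ has an even vector period.
   Context: $w(A)$ is the number of 1's in $A$. The symmetric shift register with parameters $k,p,n$ generates from $A$ the sequence $A^\infty=a_1a_2\cdots$ by: for $i\ge0$, $a_{n+i+1}=1-a_{i+1}$ if $k\le a_{i+2}+\cdots+a_{i+n}\le k+p$, and $a_{n+i+1}=a_{i+1}$ otherwise. $A^\infty$ starts with 1 and contains infinitely many 0's and 1's, so it can be written uniquely as $1_{q_1}0_{q_2}1_{q_3}0_{q_4}\cdots$ with all $q_i\ge1$ ($1_q$, $0_q$ denote $q$ consecutive 1's or 0's), and $V(A^\infty)=(q_1,q_2,\dots)$. An even vector period of $V(A^\infty)$ is an even integer $j>0$ with $q_{j+i}=q_i$ for all $i\ge1$. -}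

module Defs where

open import Data.Nat using (ℕ; zero; suc; _+_; _≤ᵇ_; _<_; _≤_)
open import Data.Bool using (Bool; true; false; not; if_then_else_; _∧_)
open import Data.Vec using (Vec; []; _∷_; _∷ʳ_)
open import Data.Nat.Properties using ()
open import Relation.Binary.PropositionalEquality using (_≡_)
open import Data.Product using (Σ; _×_; ∃)

w : ∀ {n} → Vec Bool n → ℕ
w [] = 0
w (true ∷ xs) = suc (w xs)
w (false ∷ xs) = w xs

-- One step of the symmetric shift register with parameters k, p:
-- window (a_{i+1}, ..., a_{i+n}) ↦ (a_{i+2}, ..., a_{i+n+1}), where
-- a_{i+n+1} = 1 - a_{i+1} if k ≤ a_{i+2}+...+a_{i+n} ≤ k+p, else a_{i+1}.
step : ℕ → ℕ → ∀ {n} → Vec Bool n → Vec Bool n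
step k p [] = []
step k p (a ∷ rest) =
  rest ∷ʳ (if (k ≤ᵇ w rest) ∧ (w rest ≤ᵇ k + p) then not a else a)

-- window i = (a_{i+1}, ..., a_{i+n})
window : ℕ → ℕ → ∀ {n} → Vec Bool n → ℕ → Vec Bool n
window k p A zero = A
window k p A (suc i) = step k p (window k p A i)

hd : ∀ {n} → Vec Bool n → Bool
hd [] = false
hd (x ∷ _) = x

-- A^∞ as a 0-indexed sequence: seqA k p A i = a_{i+1}
seqA : ℕ → ℕ → ∀ {n} → Vec Bool n → ℕ → Bool
seqA k p A i = hd (window k p A i)

S : (ℕ → ℕ) → ℕ → ℕ
S q zero = 0
S q (suc m) = S q m + q m

-- parity of run index: run 0 (= q_1) consists of 1's, run 1 of 0's, ...
runBit : ℕ → Bool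
runBit zero = true
runBit (suc m) = not (runBit m)

-- q (0-indexed: q m = q_{m+1}) is the run-length vector V(s) of s, i.e.
-- s = 1_{q_1} 0_{q_2} 1_{q_3} ... with all q_i ≥ 1.
IsRunVector : (ℕ → Bool) → (ℕ → ℕ) → Set
IsRunVector s q =
  (∀ m → 1 ≤ q m) ×
  (∀ m t → t < q m → s (S q m + t) ≡ runBit m)

data Even : ℕ → Set where
  even-zero : Even zero
  even-ss   : ∀ {n} → Even n → Even (suc (suc n))

-- j is an even vector period of q (0-indexed; equivalent to q_{j+i} = q_i for i ≥ 1)
IsEvenVectorPeriod : (ℕ → ℕ) → ℕ → Set
IsEvenVectorPeriod q j = Even j × 0 < j × (∀ i → q (j + i) ≡ q i)

-- The register step is invertible (the dropped bit a_{i+1} is recovered from the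
-- new window), so the sequence of windows, living in a finite set, is purely
-- periodic: A^∞ has a period P with window P = A. Since the window A of weight
-- k+p+1 arises by one step from window (P-1), the bit a_P that this step drops
-- must be 0, while a_{P+1} = a_1 = 1. Hence a run of 1's starts at position P.
-- Runs beginning a period after one another are separated by the same number j
-- of runs, so j is a vector period, and j is even because both runs consist of 1's.
module Submission where

open import Defs
open import Data.Bool using (Bool; true; false; not; _∧_; T)
open import Data.Bool.Properties using (not-injective; not-involutive; not-¬; T-∧; T-≡) renaming (_≟_ to _≟ᵇ_)
open import Data.Fin using (Fin; toℕ; combine) renaming (zero to fzero)
open import Data.Fin.Properties using (pigeonhole; combine-injective; 2↔Bool)
open import Data.Nat using (ℕ; zero; suc; _+_; _∸_; _^_; _<_; _≤_; _≤ᵇ_; z≤n; s≤s; z<s; _≤?_)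
open import Data.Nat.Properties
open import Data.Product using (Σ; _×_; ∃; _,_; proj₂)
open import Data.Sum using (_⊎_; inj₁; inj₂; [_,_]′)
open import Data.Vec using (Vec; []; _∷_; _∷ʳ_)
open import Data.Vec.Properties using (∷ʳ-injective)
open import Function.Bundles using (Injection; Equivalence; _↣_)
open import Function.Base using (id)
open import Function.Definitions using (Injective)
open import Function.Properties.Inverse using (↔-sym; ↔⇒↣)
open import Relation.Nullary using (yes; no; contradiction)
open import Relation.Binary.PropositionalEquality

module InjectiveOrbit {X : Set} (f : X → X) (f-injective : Injective _≡_ _≡_ f)
                      (x : ℕ → X) (x-suc : ∀ i → x (suc i) ≡ f (x i)) where

  cancel-prefix : ∀ i d → x i ≡ x (i + d) → x 0 ≡ x d
  cancel-prefix zero    d e = e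
  cancel-prefix (suc i) d e =
    cancel-prefix i d (f-injective (trans (sym (x-suc i)) (trans e (x-suc (i + d)))))

  returns : ∀ {N} (code : X → Fin N) → Injective _≡_ _≡_ code → ∃ λ r → x (suc r) ≡ x 0
  returns code code-injective
    with i , j , i<j , codes≡ ← pigeonhole (n<1+n _) (λ i → code (x (toℕ i)))
    with d , i+1+d≡j ← m≤n⇒∃[o]m+o≡n i<j
    = d , sym (cancel-prefix (toℕ i) (suc d) xi≡xi+1+d)
    where
    xi≡xi+1+d : x (toℕ i) ≡ x (toℕ i + suc d)
    xi≡xi+1+d = trans (code-injective codes≡) (cong x (sym (trans (+-suc (toℕ i) d) i+1+d≡j)))

  periodic : ∀ P → x P ≡ x 0 → ∀ i → x (i + P) ≡ x i
  periodic P e zero    = e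
  periodic P e (suc i) = trans (x-suc (i + P)) (trans (cong f (periodic P e i)) (sym (x-suc i)))

Bool↣Fin2 : Bool ↣ Fin 2
Bool↣Fin2 = ↔⇒↣ (↔-sym 2↔Bool)

encode : ∀ {n} → Vec Bool n → Fin (2 ^ n)
encode []      = fzero
encode (b ∷ v) = combine (Injection.to Bool↣Fin2 b) (encode v)

encode-injective : ∀ {n} → Injective _≡_ _≡_ (encode {n})
encode-injective {x = []}    {[]}    _ = refl
encode-injective {x = a ∷ u} {b ∷ v} e
  with a≡b , u≡v ← combine-injective _ (encode u) _ (encode v) e
  = cong₂ _∷_ (Injection.injective Bool↣Fin2 a≡b) (encode-injective u≡v)

step-injective : ∀ k p {n} → Injective _≡_ _≡_ (step k p {n})
step-injective k p {x = []}    {[]}    _ = refl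
step-injective k p {x = a ∷ u} {b ∷ v} e with ∷ʳ-injective u v e
... | refl , new≡ with (k ≤ᵇ w u) ∧ (w u ≤ᵇ k + p)
...   | true  = cong (_∷ u) (not-injective new≡)
...   | false = cong (_∷ u) new≡

window-returns : ∀ k p {n} (A : Vec Bool n) → ∃ λ r → window k p A (suc r) ≡ A
window-returns k p A =
  InjectiveOrbit.returns (step k p) (step-injective k p) (window k p A) (λ _ → refl)
                         encode encode-injective

window-periodic : ∀ k p {n} (A : Vec Bool n) P → window k p A P ≡ A →
                  ∀ i → window k p A (i + P) ≡ window k p A i
window-periodic k p A =
  InjectiveOrbit.periodic (step k p) (step-injective k p) (window k p A) (λ _ → refl)

w-∷ʳ-true : ∀ {n} (xs : Vec Bool n) → w (xs ∷ʳ true) ≡ suc (w xs)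
w-∷ʳ-true []           = refl
w-∷ʳ-true (true ∷ xs)  = cong suc (w-∷ʳ-true xs)
w-∷ʳ-true (false ∷ xs) = w-∷ʳ-true xs

w-∷ʳ-false : ∀ {n} (xs : Vec Bool n) → w (xs ∷ʳ false) ≡ w xs
w-∷ʳ-false []           = refl
w-∷ʳ-false (true ∷ xs)  = cong suc (w-∷ʳ-false xs)
w-∷ʳ-false (false ∷ xs) = w-∷ʳ-false xs

flip-condition : ∀ k p {m} → k ≤ m → m ≤ k + p → T ((k ≤ᵇ m) ∧ (m ≤ᵇ k + p))
flip-condition k p k≤m m≤k+p = Equivalence.from T-∧ (≤⇒≤ᵇ k≤m , ≤⇒≤ᵇ m≤k+p)

-- If a_{i+1} = 1 the register would have to append a 1 to a window of weight
-- k+p, or a 0 to one of weight k+p+1; the rule does neither.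
w-step≡k+p+1⇒hd≡false : ∀ k p {n} (B : Vec Bool n) → w (step k p B) ≡ suc (k + p) → hd B ≡ false
w-step≡k+p+1⇒hd≡false k p []             _ = refl
w-step≡k+p+1⇒hd≡false k p (false ∷ rest) _ = refl
w-step≡k+p+1⇒hd≡false k p (true ∷ rest)  e with (k ≤ᵇ w rest) ∧ (w rest ≤ᵇ k + p) in flips
... | true  = contradiction (≤ᵇ⇒≤ (w rest) (k + p) w≤k+p) (<⇒≱ (≤-reflexive (sym w≡k+p+1)))
  where
  w≤k+p : T (w rest ≤ᵇ k + p)
  w≤k+p = proj₂ (Equivalence.to T-∧ (Equivalence.from T-≡ flips))
  w≡k+p+1 : w rest ≡ suc (k + p)
  w≡k+p+1 = trans (sym (w-∷ʳ-false rest)) e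
... | false =
  contradiction (flip-condition k p (subst (k ≤_) (sym w≡k+p) (m≤m+n k p)) (≤-reflexive w≡k+p))
                (subst T flips)
  where
  w≡k+p : w rest ≡ k + p
  w≡k+p = suc-injective (trans (sym (w-∷ʳ-true rest)) e)

differences : (ℕ → ℕ) → ℕ → ℕ
differences r m = r (suc m) ∸ r m

S-differences : (r : ℕ → ℕ) → r 0 ≡ 0 → (∀ m → r m ≤ r (suc m)) → ∀ m → S (differences r) m ≡ r m
S-differences r r0≡0 _          zero    = sym r0≡0
S-differences r r0≡0 r-monotone (suc m) = begin
  S (differences r) m + (r (suc m) ∸ r m) ≡⟨ cong (_+ (r (suc m) ∸ r m)) (S-differences r r0≡0 r-monotone m) ⟩
  r m + (r (suc m) ∸ r m)                 ≡⟨ m+[n∸m]≡n (r-monotone m) ⟩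
  r (suc m)                               ∎
  where open ≡-Reasoning

differences-periodic : (r : ℕ → ℕ) (j P : ℕ) → (∀ i → r (j + i) ≡ r i + P) → ∀ i → differences r (j + i) ≡ differences r i
differences-periodic r j P r-shift i = begin
  r (suc (j + i)) ∸ r (j + i)  ≡⟨ cong (λ z → r z ∸ r (j + i)) (sym (+-suc j i)) ⟩
  r (j + suc i) ∸ r (j + i)    ≡⟨ cong₂ _∸_ (r-shift (suc i)) (r-shift i) ⟩
  (r (suc i) + P) ∸ (r i + P)  ≡⟨ cong₂ _∸_ (+-comm (r (suc i)) P) (+-comm (r i) P) ⟩
  (P + r (suc i)) ∸ (P + r i)  ≡⟨ [m+n]∸[m+o]≡n∸o P (r (suc i)) (r i) ⟩
  r (suc i) ∸ r i              ∎
  where open ≡-Reasoning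

strictlyIncreasing-hits : (r : ℕ → ℕ) (P : ℕ) → r 0 ≤ P → (∀ m → r m < r (suc m)) →
                          (∀ m → r m < P → r (suc m) ≤ P) → ∃ λ j → r j ≡ P
strictlyIncreasing-hits r P r0≤P r-increasing no-overshoot =
  [ id , (λ (P≤rP , rP<P) → contradiction P≤rP (<⇒≱ rP<P)) ]′ (climb P)
  where
  climb : ∀ m → (∃ λ j → r j ≡ P) ⊎ (m ≤ r m × r m < P)
  climb zero with m≤n⇒m<n∨m≡n r0≤P
  ... | inj₁ r0<P = inj₂ (z≤n , r0<P)
  ... | inj₂ r0≡P = inj₁ (0 , r0≡P)
  climb (suc m) with climb m
  ... | inj₁ hit = inj₁ hit
  ... | inj₂ (m≤rm , rm<P) with m≤n⇒m<n∨m≡n (no-overshoot m rm<P)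
  ...   | inj₁ rm+1<P = inj₂ (<-≤-trans (s≤s m≤rm) (r-increasing m) , rm+1<P)
  ...   | inj₂ rm+1≡P = inj₁ (suc m , rm+1≡P)

runVector-from-boundaries : (s : ℕ → Bool) (r : ℕ → ℕ) → r 0 ≡ 0 → (∀ m → r m < r (suc m)) →
                            (∀ m {z} → r m ≤ z → z < r (suc m) → s z ≡ runBit m) →
                            IsRunVector s (differences r)
runVector-from-boundaries s r r0≡0 r-increasing constant-on-run =
  (λ m → m<n⇒0<n∸m (r-increasing m)) , inside-run
  where
  inside-run : ∀ m t → t < differences r m → s (S (differences r) m + t) ≡ runBit m
  inside-run m t t<qm rewrite S-differences r r0≡0 (λ m → <⇒≤ (r-increasing m)) m =
    constant-on-run m (m≤m+n (r m) t)
      (subst (r m + t <_) (m+[n∸m]≡n (<⇒≤ (r-increasing m))) (+-monoʳ-< (r m) t<qm))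

runBit≡true⇒Even : ∀ {m} → runBit m ≡ true → Even m
runBit≡true⇒Even {zero}          _ = even-zero
runBit≡true⇒Even {suc zero}      ()
runBit≡true⇒Even {suc (suc m)} e = even-ss (runBit≡true⇒Even (trans (sym (not-involutive (runBit m))) e))

module Seek (s : ℕ → Bool) where

  seek : Bool → ℕ → ℕ → ℕ
  seek b x zero    = x
  seek b x (suc f) with s x ≟ᵇ b
  ... | yes _ = seek b (suc x) f
  ... | no  _ = x

  x≤seek : ∀ b x f → x ≤ seek b x f
  x≤seek b x zero    = ≤-refl
  x≤seek b x (suc f) with s x ≟ᵇ b
  ... | yes _ = ≤-trans (n≤1+n x) (x≤seek b (suc x) f)
  ... | no  _ = ≤-refl

  seek-constant : ∀ b x f {z} → x ≤ z → z < seek b x f → s z ≡ b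
  seek-constant b x zero    x≤z z<x = contradiction x≤z (<⇒≱ z<x)
  seek-constant b x (suc f) x≤z z<seek with s x ≟ᵇ b
  ... | no  _    = contradiction x≤z (<⇒≱ z<seek)
  ... | yes sx≡b with m≤n⇒m<n∨m≡n x≤z
  ...   | inj₁ x<z  = seek-constant b (suc x) f x<z z<seek
  ...   | inj₂ refl = sx≡b

  seek-differs : ∀ b x f {y} → x ≤ y → y ≤ x + f → s y ≢ b → s (seek b x f) ≢ b
  seek-differs b x zero {y} x≤y y≤x+0 sy≢b
    with refl ← ≤-antisym x≤y (subst (y ≤_) (+-identityʳ x) y≤x+0) = sy≢b
  seek-differs b x (suc f) {y} x≤y y≤x+f+1 sy≢b with s x ≟ᵇ b
  ... | no  sx≢b = sx≢b
  ... | yes sx≡b with m≤n⇒m<n∨m≡n x≤y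
  ...   | inj₁ x<y  = seek-differs b (suc x) f x<y (subst (y ≤_) (+-suc x f) y≤x+f+1) sy≢b
  ...   | inj₂ refl = contradiction sx≡b sy≢b

module PeriodicRuns (s : ℕ → Bool) (p : ℕ) (periodic : ∀ x → s (x + suc p) ≡ s x)
                    (s0≡true : s 0 ≡ true) (sp≡false : s p ≡ false) where

  open Seek s

  P : ℕ
  P = suc p

  sP≡true : s P ≡ true
  sP≡true = trans (periodic 0) s0≡true

  occurs-in-period : ∀ b → ∃ λ c → c < P × s c ≡ b
  occurs-in-period true  = 0 , z<s , s0≡true
  occurs-in-period false = p , n<1+n p , sp≡false

  occurs-in-every-window : ∀ b x → ∃ λ y → x ≤ y × y < x + P × s y ≡ b
  occurs-in-every-window b zero with c , c<P , sc≡b ← occurs-in-period b = c , z≤n , c<P , sc≡b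
  occurs-in-every-window b (suc x) with occurs-in-every-window b x
  ... | y , x≤y , y<x+P , sy≡b with m≤n⇒m<n∨m≡n x≤y
  ...   | inj₁ x<y  = y , x<y , m<n⇒m<1+n y<x+P , sy≡b
  ...   | inj₂ refl = x + P , subst (suc x ≤_) (sym (+-suc x p)) (s≤s (m≤m+n x p)) , n<1+n (x + P)
                    , trans (periodic x) sy≡b

  nextChange : ℕ → ℕ
  nextChange x = seek (s x) (suc x) p

  x<nextChange : ∀ x → x < nextChange x
  x<nextChange x = x≤seek (s x) (suc x) p

  nextChange-constant : ∀ x {z} → x ≤ z → z < nextChange x → s z ≡ s x
  nextChange-constant x x≤z z<next with m≤n⇒m<n∨m≡n x≤z
  ... | inj₁ x<z  = seek-constant (s x) (suc x) p x<z z<next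
  ... | inj₂ refl = refl

  nextChange-differs : ∀ x → s (nextChange x) ≡ not (s x)
  nextChange-differs x
    with y , x<y , y<x+1+P , sy≡¬sx ← occurs-in-every-window (not (s x)) (suc x) =
    ≢not⇒≡not (seek-differs (s x) (suc x) p x<y (≤-pred y<x+1+P′) (λ sy≡sx → not-¬ sy≡sx sy≡¬sx))
    where
    y<x+1+P′ : y < suc (suc x + p)
    y<x+1+P′ = subst (y <_) (+-suc (suc x) p) y<x+1+P
    ≢not⇒≡not : ∀ {a b} → a ≢ b → a ≡ not b
    ≢not⇒≡not {true}  {true}  a≢b = contradiction refl a≢b
    ≢not⇒≡not {true}  {false} _   = refl
    ≢not⇒≡not {false} {true}  _   = refl
    ≢not⇒≡not {false} {false} a≢b = contradiction refl a≢b

  seek-shift : ∀ b z f → seek b (z + P) f ≡ seek b z f + P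
  seek-shift b z zero = refl
  seek-shift b z (suc f) with s (z + P) ≟ᵇ b | s z ≟ᵇ b
  ... | yes _          | yes _    = seek-shift b (suc z) f
  ... | no  _          | no  _    = refl
  ... | yes sz+P≡b     | no  sz≢b = contradiction (trans (sym (periodic z)) sz+P≡b) sz≢b
  ... | no  sz+P≢b     | yes sz≡b = contradiction (trans (periodic z) sz≡b) sz+P≢b

  nextChange-shift : ∀ x → nextChange (x + P) ≡ nextChange x + P
  nextChange-shift x rewrite periodic x = seek-shift (s x) (suc x) p

  runStart : ℕ → ℕ
  runStart zero    = 0
  runStart (suc m) = nextChange (runStart m)

  runStart-increasing : ∀ m → runStart m < runStart (suc m)
  runStart-increasing m = x<nextChange (runStart m)

  s-runStart : ∀ m → s (runStart m) ≡ runBit m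
  s-runStart zero    = s0≡true
  s-runStart (suc m) = trans (nextChange-differs (runStart m)) (cong not (s-runStart m))

  -- s changes between positions p and P, so no run straddles P.
  runStart-no-overshoot : ∀ m → runStart m < P → runStart (suc m) ≤ P
  runStart-no-overshoot m start<P with runStart (suc m) ≤? P
  ... | yes next≤P = next≤P
  ... | no  next≰P = contradiction (trans (sym sP≡true) (trans sP≡sp sp≡false)) (λ ())
    where
    P<next : P < runStart (suc m)
    P<next = ≰⇒> next≰P
    sP≡sp : s P ≡ s p
    sP≡sp = trans (nextChange-constant (runStart m) (<⇒≤ start<P) P<next)
                  (sym (nextChange-constant (runStart m) (≤-pred start<P) (<-trans (n<1+n p) P<next)))

  runStart-shift : ∀ j → runStart j ≡ P → ∀ i → runStart (j + i) ≡ runStart i + P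
  runStart-shift j startj≡P zero rewrite +-identityʳ j = startj≡P
  runStart-shift j startj≡P (suc i) rewrite +-suc j i | runStart-shift j startj≡P i =
    nextChange-shift (runStart i)

  evenVectorPeriod : Σ (ℕ → ℕ) (λ q → IsRunVector s q × ∃ (λ j → IsEvenVectorPeriod q j))
  evenVectorPeriod
    with j , startj≡P ← strictlyIncreasing-hits runStart P z≤n runStart-increasing
                                                runStart-no-overshoot
    = differences runStart
    , runVector-from-boundaries s runStart refl runStart-increasing
        (λ m start≤z z<next → trans (nextChange-constant (runStart m) start≤z z<next) (s-runStart m))
    , j
    , runBit≡true⇒Even (trans (sym (s-runStart j)) (trans (cong s startj≡P) sP≡true))
    , n≢0⇒n>0 (λ j≡0 → 0≢1+n (trans (cong runStart (sym j≡0)) startj≡P))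
    , differences-periodic runStart j P (runStart-shift j startj≡P)

mainTheorem4 : (k p n : ℕ) → k + p < n → (A : Vec Bool n) →
    hd A ≡ true → w A ≡ suc (k + p) →
    Σ (ℕ → ℕ) (λ q → IsRunVector (seqA k p A) q × ∃ (λ j → IsEvenVectorPeriod q j))
mainTheorem4 k p n _ A hdA≡true wA≡k+p+1
  with r , returns ← window-returns k p A =
  PeriodicRuns.evenVectorPeriod (seqA k p A) r
    (λ i → cong hd (window-periodic k p A (suc r) returns i))
    hdA≡true
    (w-step≡k+p+1⇒hd≡false k p (window k p A r) (trans (cong w returns) wA≡k+p+1))
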